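{- Let $T$ be a tree with at least one edge and let $C$ be any cycle of length at least $4$. Then $\chi_s'(T\Box C)\ge 2\Delta(T)+4$.
   Context: $\Delta(T)$ is the maximum degree of $T$. The Cartesian product $G\Box H$ has vertex set $V(G)\times V(H)$, with $(a,u)\sim(b,v)$ iff either $a=b$ and $uv\in E(H)$, or $u=v$ and $ab\in E(G)$. A strong edge coloring is a proper edge coloring in which every color class is an induced matching; $\chi_s'(G)$ is the minimum number of colors in such a coloring. -}

module Defs where

open import Data.Nat using (ℕ; zero; suc; _+_; _*_; _⊔_; _≤_; _%_)
open import Data.Fin using (Fin; toℕ)
open import Data.Fin.Properties using (_≟_)
open import Data.Bool using (Bool; true; false; _∧_; _∨_)
open import Data.List using (List; []; _∷_; length; filter; map; foldr)
open import Data.List.Base using (allFin)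
open import Data.List.Relation.Unary.Unique.Propositional using (Unique)
open import Data.Product using (_×_; _,_; ∃; ∃-syntax)
open import Relation.Binary.PropositionalEquality using (_≡_; _≢_)
open import Relation.Nullary using (¬_; does)

record Graph (n : ℕ) : Set where
  field
    adj    : Fin n → Fin n → Bool
    sym    : ∀ x y → adj x y ≡ adj y x
    irrefl : ∀ x → adj x x ≡ false

open Graph public

Adj : ∀ {n} → Graph n → Fin n → Fin n → Set
Adj G x y = adj G x y ≡ true

IsWalk : ∀ {n} → Graph n → List (Fin n) → Set
IsWalk G []           = Data.Unit.⊤ where import Data.Unit
IsWalk G (x ∷ [])     = Data.Unit.⊤ where import Data.Unit
IsWalk G (x ∷ y ∷ xs) = Adj G x y × IsWalk G (y ∷ xs)

last : ∀ {A : Set} → A → List A → A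
last x []       = x
last x (y ∷ ys) = last y ys

Connected : ∀ {n} → Graph n → Set
Connected G = ∀ u v → ∃[ xs ] (IsWalk G (u ∷ xs) × last u xs ≡ v)

HasCycle : ∀ {n} → Graph n → Set
HasCycle G = ∃[ x ] ∃[ y ] ∃[ z ] ∃[ ws ]
  ( Unique (x ∷ y ∷ z ∷ ws)
  × IsWalk G (x ∷ y ∷ z ∷ ws)
  × Adj G (last z ws) x )

IsTree : ∀ {n} → Graph n → Set
IsTree G = Connected G × ¬ HasCycle G

degree : ∀ {n} → Graph n → Fin n → ℕ
degree {n} G v = length (filter (λ w → adj G v w ≡? true) (allFin n))
  where
  open import Data.Bool.Properties renaming (_≟_ to _≡?_)

Δ : ∀ {n} → Graph n → ℕ
Δ {n} G = foldr _⊔_ 0 (map (degree G) (allFin n))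

-- cycle C_m on vertices Fin m: i ~ j iff j ≡ i+1 (mod m) or i ≡ j+1 (mod m)
-- (used only for m ≥ 4; irreflexive and symmetric require m ≥ 3)
cycleAdj : ∀ m → Fin m → Fin m → Bool
cycleAdj (suc m) i j =
  does (toℕ j Data.Nat.≟ ((toℕ i + 1) % suc m)) ∨ does (toℕ i Data.Nat.≟ ((toℕ j + 1) % suc m))
  where import Data.Nat
cycleAdj zero () j

-- A strong edge colouring of a graph with vertex type V and adjacency E
-- using k colours. col is a colour assigned to each ordered pair; only its
-- values on edges matter, and it is required to be symmetric on edges.
-- Strongness (every colour class is an induced matching): for any two
-- distinct edges xy, uv of the same colour (quantified over all
-- orientations), x ≠ u and x is not adjacent to u.
record StrongEdgeColoring {V : Set} (E : V → V → Set) (k : ℕ) : Set where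
  field
    col     : V → V → Fin k
    col-sym : ∀ x y → E x y → col x y ≡ col y x
    strong  : ∀ x y u v → E x y → E u v → col x y ≡ col u v →
              ¬ (x ≡ u × y ≡ v) → ¬ (x ≡ v × y ≡ u) →
              x ≢ u × ¬ E x u

BoxAdj : ∀ {n} → Graph n → (m : ℕ) → (Fin n × Fin m) → (Fin n × Fin m) → Set
BoxAdj G m (a , u) (b , v) =
  (a ≡ b × cycleAdj m u v ≡ true) Data.Sum.⊎ (u ≡ v × Adj G a b)
  where import Data.Sum

χs-Box-≥ : ∀ {n} → Graph n → (m r : ℕ) → Set
χs-Box-≥ G m r = ∀ k → StrongEdgeColoring (BoxAdj G m) k → r ≤ k

-- Let v be a vertex of T of maximum degree d with a neighbour w.  In T □ C the
-- edge (v,1)(v,2), the d + 1 further edges at each of its ends, and the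
-- opposite side (w,1)(w,2) of the square v,w × 1,2 are pairwise joined by an
-- edge or share an end, so a strong edge colouring gives them 2d + 4 distinct
-- colours.
module Submission where

open import Defs hiding (sym)
open import Data.Nat using (ℕ; _+_; _*_; _≤_)
open import Data.Fin using (Fin)
open import Data.Product using (∃-syntax; _×_)

open import Data.Nat using (suc; z≤n; s≤s; _⊔_; _%_)
import Data.Nat as ℕ
open import Data.Nat.Properties using (≤-trans; m≤n+m; ⊔-sel)
open import Data.Nat.Tactic.RingSolver using (solve-∀)
open import Data.Fin using (zero; suc; toℕ)
open import Data.Fin.Properties using (injective⇒≤)
open import Data.Product using (_,_; proj₁; proj₂)
open import Data.Sum using (_⊎_; inj₁; inj₂; [_,_]′)
open import Data.Bool using (true)
open import Data.Bool.Properties using (∨-comm) renaming (_≟_ to _≡?_)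
open import Data.List using (List; []; _∷_; length; filter; map; _++_; lookup)
open import Data.List.Base using (allFin)
open import Data.List.Properties using (length-++; length-map; foldr-preservesᵇ)
open import Data.List.Membership.Propositional.Properties using (∈-lookup)
open import Data.List.Relation.Unary.All as All using (All; []; _∷_)
import Data.List.Relation.Unary.All.Properties as All
open import Data.List.Relation.Unary.AllPairs using (AllPairs; []; _∷_)
import Data.List.Relation.Unary.AllPairs.Properties as AllPairs
open import Data.List.Relation.Unary.Unique.Propositional using (Unique)
import Data.List.Relation.Unary.Unique.Propositional.Properties as Unique
open import Relation.Binary.PropositionalEquality
open import Relation.Nullary using (¬_; does)
open import Data.Empty using (⊥-elim)
open import Function using (_∘_)

private
  variable
    A : Set

AllPairs-mapWith : {P : A → Set} {R S : A → A → Set} →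
  (∀ {x y} → P x → P y → R x y → S x y) →
  ∀ {xs} → All P xs → AllPairs R xs → AllPairs S xs
AllPairs-mapWith f []         []         = []
AllPairs-mapWith f (px ∷ pxs) (rx ∷ rxs) =
  All.zipWith (λ (py , r) → f px py r) (pxs , rx) ∷ AllPairs-mapWith f pxs rxs

lookup-injective : ∀ {xs : List A} → Unique xs →
  ∀ {i j} → lookup xs i ≡ lookup xs j → i ≡ j
lookup-injective (_  ∷ _) {zero}  {zero}  _  = refl
lookup-injective (x∉ ∷ _) {zero}  {suc j} eq = ⊥-elim (All.lookup x∉ (∈-lookup j) eq)
lookup-injective (x∉ ∷ _) {suc i} {zero}  eq = ⊥-elim (All.lookup x∉ (∈-lookup i) (sym eq))
lookup-injective (_  ∷ u) {suc i} {suc j} eq = cong suc (lookup-injective u eq)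

Unique⇒length≤ : ∀ {k} {xs : List (Fin k)} → Unique xs → length xs ≤ k
Unique⇒length≤ u = injective⇒≤ (lookup-injective u)

⊔-preserves : (P : ℕ → Set) → ∀ {x y} → P x → P y → P (x ⊔ y)
⊔-preserves P {x} {y} px py =
  [ (λ eq → subst P (sym eq) px) , (λ eq → subst P (sym eq) py) ]′ (⊔-sel x y)

module StrongEdgeColoringBound
  {V : Set} {E : V → V → Set} (E-sym : ∀ {x y} → E x y → E y x)
  {k : ℕ} (χ : StrongEdgeColoring E k) where

  open StrongEdgeColoring χ

  Near : V → V → Set
  Near x u = x ≡ u ⊎ E x u

  DistinctEdges : V → V → V → V → Set
  DistinctEdges x y u v = (x ≢ u ⊎ y ≢ v) × (x ≢ v ⊎ y ≢ u)

  near⇒col≢ : ∀ {x y u v} → E x y → E u v → Near x u →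
    DistinctEdges x y u v → col x y ≢ col u v
  near⇒col≢ {x} {y} {u} {v} exy euv near (d₁ , d₂) eq =
    let x≢u , ¬Exu = strong x y u v exy euv eq (refute d₁) (refute d₂)
    in [ x≢u , ¬Exu ]′ near
    where
    refute : ∀ {a b c d : V} → a ≢ b ⊎ c ≢ d → ¬ (a ≡ b × c ≡ d)
    refute (inj₁ a≢b) (a≡b , _) = a≢b a≡b
    refute (inj₂ c≢d) (_ , c≡d) = c≢d c≡d

  near′⇒col≢ : ∀ {x y u v} → E x y → E u v → Near y u →
    DistinctEdges y x u v → col x y ≢ col u v
  near′⇒col≢ {x} {y} exy euv near d eq =
    near⇒col≢ (E-sym exy) euv near d (trans (sym (col-sym x y exy)) eq)

  Spoke : V → V → V → Set
  Spoke p q r = E p r × p ≢ r × q ≢ r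

  spokes : ∀ {p q Rs} → All (E p) Rs → Unique (p ∷ q ∷ Rs) →
    All (Spoke p q) Rs × Unique Rs
  spokes es ((_ ∷ p∉) ∷ q∉ ∷ u) = All.zip (es , All.zip (p∉ , q∉)) , u

  -- Any two of the edges at p or q and the opposite side p'q' of the square
  -- share an end or have adjacent ends, so all their colours differ.
  square-bound : ∀ {p q p' q' Ps Qs} →
    E p q → E p p' → E q q' → E p' q' → Unique (p ∷ q ∷ p' ∷ q' ∷ []) →
    All (E p) Ps → Unique (p ∷ q ∷ Ps) → All (E q) Qs → Unique (q ∷ p ∷ Qs) →
    2 + (length Ps + length Qs) ≤ k
  square-bound {p} {q} {p'} {q'} {Ps} {Qs} epq epp' eqq' ep'q'
    ((p≢q ∷ p≢p' ∷ p≢q' ∷ []) ∷ (q≢p' ∷ q≢q' ∷ []) ∷ _)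
    eP uP eQ uQ = subst (_≤ k) length-colours (Unique⇒length≤ colours-unique)
    where
    sP : All (Spoke p q) Ps
    sP = proj₁ (spokes eP uP)
    sQ : All (Spoke q p) Qs
    sQ = proj₁ (spokes eQ uQ)

    fan : List (Fin k)
    fan = map (col p) Ps ++ map (col q) Qs

    colours : List (Fin k)
    colours = col p q ∷ col p' q' ∷ fan

    length-colours : length colours ≡ 2 + (length Ps + length Qs)
    length-colours = cong (2 +_) (trans (length-++ (map (col p) Ps))
      (cong₂ _+_ (length-map (col p) Ps) (length-map (col q) Qs)))

    fan-distinct : ∀ {c} → (∀ {r} → Spoke p q r → c ≢ col p r) →
      (∀ {s} → Spoke q p s → c ≢ col q s) → All (c ≢_) fan
    fan-distinct fp fq =
      All.++⁺ (All.map⁺ (All.map fp sP)) (All.map⁺ (All.map fq sQ))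

    spoke-spoke : ∀ {a b r r'} → Spoke a b r → Spoke a b r' → r ≢ r' → col a r ≢ col a r'
    spoke-spoke (er , _) (er' , a≢r' , _) r≢r' =
      near⇒col≢ er er' (inj₁ refl) (inj₂ r≢r' , inj₁ a≢r')

    Pspoke-Qspoke : ∀ {r s} → Spoke p q r → Spoke q p s → col p r ≢ col q s
    Pspoke-Qspoke (er , _) (es , _ , p≢s) =
      near⇒col≢ er es (inj₂ epq) (inj₁ p≢q , inj₁ p≢s)

    colours-unique : Unique colours
    colours-unique =
        (near⇒col≢ epq ep'q' (inj₂ epp') (inj₁ p≢p' , inj₁ p≢q')
        ∷ fan-distinct
            (λ (er , p≢r , q≢r) → near⇒col≢ epq er (inj₁ refl) (inj₂ q≢r , inj₁ p≢r))
            (λ (es , _ , p≢s) → near⇒col≢ epq es (inj₂ epq) (inj₁ p≢q , inj₁ p≢s)))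
      ∷ fan-distinct
          (λ (er , _) → near⇒col≢ ep'q' er (inj₂ (E-sym epp'))
                                  (inj₁ (≢-sym p≢p') , inj₂ (≢-sym p≢q')))
          (λ (es , _) → near′⇒col≢ ep'q' es (inj₂ (E-sym eqq'))
                                   (inj₁ (≢-sym q≢q') , inj₂ (≢-sym q≢p')))
      ∷ AllPairs.++⁺
          (AllPairs.map⁺ (AllPairs-mapWith spoke-spoke sP (proj₂ (spokes eP uP))))
          (AllPairs.map⁺ (AllPairs-mapWith spoke-spoke sQ (proj₂ (spokes eQ uQ))))
          (All.map⁺ (All.map (λ sp → All.map⁺ (All.map (Pspoke-Qspoke sp) sQ)) sP))

Adj⇒≢ : ∀ {n} {G : Graph n} {x y} → Adj G x y → x ≢ y
Adj⇒≢ {G = G} {x} a refl with () ← trans (sym (irrefl G x)) a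

cycleAdj-sym : ∀ m u v → cycleAdj m u v ≡ cycleAdj m v u
cycleAdj-sym (suc m) u v =
  ∨-comm (does (toℕ v ℕ.≟ (toℕ u + 1) % suc m)) (does (toℕ u ℕ.≟ (toℕ v + 1) % suc m))

BoxAdj-sym : ∀ {n} {G : Graph n} {m x y} → BoxAdj G m x y → BoxAdj G m y x
BoxAdj-sym {G = G} {m} {_ , u} {_ , v} (inj₁ (refl , uv)) = inj₁ (refl , trans (cycleAdj-sym m v u) uv)
BoxAdj-sym {G = G} {m} {a , _} {b , _} (inj₂ (refl , ab)) = inj₂ (refl , trans (Graph.sym G b a) ab)

module SquareInProduct {n : ℕ} (T : Graph n) (m' : ℕ) {k : ℕ}
  (χ : StrongEdgeColoring (BoxAdj T (4 + m')) k) where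

  open StrongEdgeColoringBound (BoxAdj-sym {G = T}) χ

  V : Set
  V = Fin n × Fin (4 + m')

  layer : Fin (4 + m') → List (Fin n) → List V
  layer c = map (λ x → x , c)

  ≢-snd : ∀ {a b : Fin n} {c d : Fin (4 + m')} → c ≢ d → (a , c) ≢ (b , d)
  ≢-snd c≢d = c≢d ∘ cong proj₂

  layer-unique : ∀ {c xs} → Unique xs → Unique (layer c xs)
  layer-unique = Unique.map⁺ (cong proj₁)

  ∉-other-layer : ∀ {a c d} {xs} → d ≢ c → All ((a , d) ≢_) (layer c xs)
  ∉-other-layer d≢c = All.map⁺ (All.tabulate (λ _ → ≢-snd d≢c))

  fan-unique : ∀ {v N c d e} → c ≢ d → c ≢ e → d ≢ e → Unique (v ∷ N) →
    Unique ((v , c) ∷ (v , d) ∷ (v , e) ∷ layer c N)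
  fan-unique c≢d c≢e d≢e u with v∉ ∷ uN ← layer-unique u =
      (≢-snd c≢d ∷ ≢-snd c≢e ∷ v∉)
    ∷ (≢-snd d≢e ∷ ∉-other-layer (≢-sym c≢d))
    ∷ ∉-other-layer (≢-sym c≢e)
    ∷ uN

  -- The square sits at cycle positions 1 and 2, so that the other cycle
  -- neighbours of its corners are the positions 0 and 3, distinct as m ≥ 4.
  c₀ c₁ c₂ c₃ : Fin (4 + m')
  c₀ = zero
  c₁ = suc zero
  c₂ = suc (suc zero)
  c₃ = suc (suc (suc zero))

  neighbours-bound : ∀ {v w N} → Adj T v w → Unique N → All (Adj T v) N →
    2 * length N + 4 ≤ k
  neighbours-bound {v} {w} {N} vw uN aN =
    subst (_≤ k) count
      (square-bound (inj₁ (refl , refl)) (inj₂ (refl , vw)) (inj₂ (refl , vw))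
        (inj₁ (refl , refl)) corners-unique
        (spokes-adj {c₁} {c₀} refl) (fan-unique (λ ()) (λ ()) (λ ()) v∉N)
        (spokes-adj {c₂} {c₃} refl) (fan-unique (λ ()) (λ ()) (λ ()) v∉N))
    where
    v∉N : Unique (v ∷ N)
    v∉N = All.map (Adj⇒≢ {G = T}) aN ∷ uN

    v≢w : v ≢ w
    v≢w = Adj⇒≢ {G = T} vw

    corners-unique : Unique ((v , c₁) ∷ (v , c₂) ∷ (w , c₁) ∷ (w , c₂) ∷ [])
    corners-unique =
        (≢-snd (λ ()) ∷ v≢w ∘ cong proj₁ ∷ ≢-snd (λ ()) ∷ [])
      ∷ (≢-snd (λ ()) ∷ v≢w ∘ cong proj₁ ∷ [])
      ∷ (≢-snd (λ ()) ∷ [])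
      ∷ []
      ∷ []

    spokes-adj : ∀ {c d} → cycleAdj (4 + m') c d ≡ true →
      All (BoxAdj T (4 + m') (v , c)) ((v , d) ∷ layer c N)
    spokes-adj cd = inj₁ (refl , cd) ∷ All.map⁺ (All.map (λ a → inj₂ (refl , a)) aN)

    count : 2 + (suc (length (layer c₁ N)) + suc (length (layer c₂ N)))
          ≡ 2 * length N + 4
    count = trans (cong₂ (λ a b → 2 + (suc a + suc b)) (length-map _ N) (length-map _ N))
                  (two-fans (length N))
      where
      two-fans : ∀ d → 2 + (suc d + suc d) ≡ 2 * d + 4
      two-fans = solve-∀

  neighbours : Fin n → List (Fin n)
  neighbours v = filter (λ w → adj T v w ≡? true) (allFin n)

  neighbours-unique : ∀ v → Unique (neighbours v)
  neighbours-unique v = Unique.filter⁺ _ (Unique.allFin⁺ n)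

  neighbours-adj : ∀ v → All (Adj T v) (neighbours v)
  neighbours-adj v = All.all-filter _ (allFin n)

  degree-bound : 4 ≤ k → ∀ v → 2 * degree T v + 4 ≤ k
  degree-bound four v = go (neighbours-unique v) (neighbours-adj v)
    where
    go : ∀ {N} → Unique N → All (Adj T v) N → 2 * length N + 4 ≤ k
    go {[]}    _  _           = four
    go {_ ∷ _} uN aN@(vw ∷ _) = neighbours-bound vw uN aN

  edge⇒four≤ : ∀ {a b} → Adj T a b → 4 ≤ k
  edge⇒four≤ {a} ab = ≤-trans (m≤n+m 4 _)
    (neighbours-bound ab (neighbours-unique a) (neighbours-adj a))

lemma8 : ∀ {n} (T : Graph n) → IsTree T → (∃[ a ] ∃[ b ] Adj T a b) →
    ∀ m → 4 ≤ m → χs-Box-≥ T m (2 * Δ T + 4)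
lemma8 {n} T _ (_ , _ , ab) _ (s≤s (s≤s (s≤s (s≤s {n = m'} z≤n)))) k χ =
  foldr-preservesᵇ {P = P} (λ {x} {y} → ⊔-preserves P {x} {y}) four
    (All.map⁺ (All.universal (degree-bound four) (allFin n)))
  where
  open SquareInProduct T m' χ
  P : ℕ → Set
  P d = 2 * d + 4 ≤ k
  four : 4 ≤ k
  four = edge⇒four≤ ab
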